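{- Let $G=(V,E)$ be a $\delta$-hyperbolic graph. For all vertices $c,v,x,y\in V$, we have $d(x,v)-d(x,y)\ge d(c,v)-d(y,c)-2\delta$ or $d(y,v)-d(x,y)\ge d(c,v)-d(x,c)-2\delta$.
   Context: $G$ is finite, connected, undirected, unweighted, with shortest-path distance $d$. $G$ is $\delta$-hyperbolic ($\delta\ge0$) if for any four vertices $u,v,x,y$, the two largest of the three sums $d(u,v)+d(x,y)$, $d(u,x)+d(v,y)$, $d(u,y)+d(v,x)$ differ by at most $2\delta$.
   Formalization: The hyperbolicity constant δ is taken over the nonnegative rationals. -}

module Defs where

open import Data.Nat as ℕ using (ℕ; zero; suc; _⊔_; _⊓_)
open import Data.Fin using (Fin)
open import Data.Integer using (+_)
open import Data.Rational as ℚ using (ℚ; _/_; NonNegative)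
open import Data.Product using (∃; _×_)
open import Relation.Nullary using (¬_)
open import Relation.Binary.PropositionalEquality using (_≡_)

record Graph (n : ℕ) : Set₁ where
  field
    Adj       : Fin n → Fin n → Set
    adj-sym   : ∀ {u v} → Adj u v → Adj v u
    adj-irrefl : ∀ {u} → ¬ Adj u u

data Walk {n : ℕ} (G : Graph n) : Fin n → Fin n → ℕ → Set where
  [] : ∀ {u} → Walk G u u zero
  _∷_ : ∀ {u w v k} → Graph.Adj G u w → Walk G w v k → Walk G u v (suc k)

Connected : ∀ {n} → Graph n → Set
Connected G = ∀ u v → ∃ λ k → Walk G u v k

IsDistance : ∀ {n} → Graph n → Fin n → Fin n → ℕ → Set
IsDistance G u v k = Walk G u v k × (∀ m → Walk G u v m → k ℕ.≤ m)

IsDistFun : ∀ {n} → Graph n → (Fin n → Fin n → ℕ) → Set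
IsDistFun G d = ∀ u v → IsDistance G u v (d u v)

⟦_⟧ : ℕ → ℚ
⟦ k ⟧ = + k / 1

-- largest and second largest of three naturals
max3 : ℕ → ℕ → ℕ → ℕ
max3 a b c = a ⊔ (b ⊔ c)

mid3 : ℕ → ℕ → ℕ → ℕ
mid3 a b c = (a ⊓ b) ⊔ ((a ⊔ b) ⊓ c)

Hyperbolic : ∀ {n} → Graph n → (Fin n → Fin n → ℕ) → ℚ → Set
Hyperbolic {n} G d δ =
  ∀ (u v x y : Fin n) →
    let s₁ = d u v ℕ.+ d x y
        s₂ = d u x ℕ.+ d v y
        s₃ = d u y ℕ.+ d v x
    in ⟦ max3 s₁ s₂ s₃ ⟧ ℚ.≤ ⟦ mid3 s₁ s₂ s₃ ⟧ ℚ.+ (δ ℚ.+ δ)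

-- Apply the four-point condition to (x, y, c, v): the sum d(x,y) + d(c,v) is at
-- most 2δ above the larger of d(x,c) + d(y,v) and d(x,v) + d(y,c), and according
-- to which of the two is larger, moving terms across gives one of the two
-- disjuncts. Only the four-point condition is needed, not that d is a graph metric.
module Submission where

open import Defs
open import Data.Nat using (ℕ)
open import Data.Fin using (Fin)
open import Data.Rational using (ℚ; _≤_; _+_; _-_; NonNegative)
open import Data.Sum using (_⊎_; inj₁; inj₂)
import Data.Sum as Sum
import Data.Nat as ℕ
import Data.Nat.Properties as ℕ
import Data.Integer as ℤ
import Data.Integer.Properties as ℤ
import Data.Rational as ℚ
import Data.Rational.Properties as ℚ
import Data.Rational.Unnormalised as ℚᵘ
import Data.Rational.Unnormalised.Properties as ℚᵘ
open import Data.Nat.Coprimality as Coprime using (Coprime; 1-coprimeTo)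
open import Relation.Binary.PropositionalEquality
open import Data.Rational.Solver using (module +-*-Solver)

coprimeTo-1 : ∀ k → Coprime k 1
coprimeTo-1 k = Coprime.sym (1-coprimeTo k)

fromℕ : ℕ → ℚ
fromℕ k = ℚ.mkℚ (ℤ.+ k) 0 (coprimeTo-1 k)

⟦⟧≡fromℕ : ∀ k → ⟦ k ⟧ ≡ fromℕ k
⟦⟧≡fromℕ k = ℚ.normalize-coprime (coprimeTo-1 k)

fromℕ-mono-≤ : ∀ {a b} → a ℕ.≤ b → fromℕ a ≤ fromℕ b
fromℕ-mono-≤ {a} {b} a≤b =
  ℚ.*≤* (subst₂ ℤ._≤_ (sym (ℤ.*-identityʳ (ℤ.+ a))) (sym (ℤ.*-identityʳ (ℤ.+ b))) (ℤ.+≤+ a≤b))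

fromℕ-homo-+ : ∀ a b → fromℕ (a ℕ.+ b) ≡ fromℕ a + fromℕ b
fromℕ-homo-+ a b = ℚ.toℚᵘ-injective (ℚᵘ.≃-trans sum≃ (ℚᵘ.≃-sym (ℚ.toℚᵘ-homo-+ (fromℕ a) (fromℕ b))))
  where
  sum≃ : ℚ.toℚᵘ (fromℕ (a ℕ.+ b)) ℚᵘ.≃ ℚ.toℚᵘ (fromℕ a) ℚᵘ.+ ℚ.toℚᵘ (fromℕ b)
  sum≃ = ℚᵘ.*≡* (cong (ℤ._* ℤ.+ 1) (sym (cong₂ ℤ._+_ (ℤ.*-identityʳ (ℤ.+ a)) (ℤ.*-identityʳ (ℤ.+ b)))))

⟦⟧-mono-≤ : ∀ {a b} → a ℕ.≤ b → ⟦ a ⟧ ≤ ⟦ b ⟧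
⟦⟧-mono-≤ {a} {b} a≤b = subst₂ _≤_ (sym (⟦⟧≡fromℕ a)) (sym (⟦⟧≡fromℕ b)) (fromℕ-mono-≤ a≤b)

⟦⟧-homo-+ : ∀ a b → ⟦ a ℕ.+ b ⟧ ≡ ⟦ a ⟧ + ⟦ b ⟧
⟦⟧-homo-+ a b = begin
  ⟦ a ℕ.+ b ⟧           ≡⟨ ⟦⟧≡fromℕ (a ℕ.+ b) ⟩
  fromℕ (a ℕ.+ b)       ≡⟨ fromℕ-homo-+ a b ⟩
  fromℕ a + fromℕ b     ≡⟨ sym (cong₂ _+_ (⟦⟧≡fromℕ a) (⟦⟧≡fromℕ b)) ⟩
  ⟦ a ⟧ + ⟦ b ⟧         ∎
  where open ≡-Reasoning

mid3≤⊔ : ∀ a b c → mid3 a b c ℕ.≤ b ℕ.⊔ c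
mid3≤⊔ a b c = ℕ.⊔-lub (ℕ.≤-trans (ℕ.m⊓n≤n a b) (ℕ.m≤m⊔n b c))
                       (ℕ.≤-trans (ℕ.m⊓n≤n (a ℕ.⊔ b) c) (ℕ.m≤n⊔m b c))

hyperbolic⇒≤⊔+2δ : ∀ {n} (G : Graph n) (d : Fin n → Fin n → ℕ) (δ : ℚ) →
  Hyperbolic G d δ → ∀ u v x y →
  ⟦ d u v ℕ.+ d x y ⟧ ≤ ⟦ (d u x ℕ.+ d v y) ℕ.⊔ (d u y ℕ.+ d v x) ⟧ + (δ + δ)
hyperbolic⇒≤⊔+2δ G d δ hyp u v x y = begin
  ⟦ s₁ ⟧                          ≤⟨ ⟦⟧-mono-≤ (ℕ.m≤m⊔n s₁ (s₂ ℕ.⊔ s₃)) ⟩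
  ⟦ max3 s₁ s₂ s₃ ⟧               ≤⟨ hyp u v x y ⟩
  ⟦ mid3 s₁ s₂ s₃ ⟧ + (δ + δ)     ≤⟨ ℚ.+-monoˡ-≤ (δ + δ) (⟦⟧-mono-≤ (mid3≤⊔ s₁ s₂ s₃)) ⟩
  ⟦ s₂ ℕ.⊔ s₃ ⟧ + (δ + δ)         ∎
  where
  open ℚ.≤-Reasoning
  s₁ = d u v ℕ.+ d x y
  s₂ = d u x ℕ.+ d v y
  s₃ = d u y ℕ.+ d v x

hyperbolic⇒≤+2δ : ∀ {n} (G : Graph n) (d : Fin n → Fin n → ℕ) (δ : ℚ) →
  Hyperbolic G d δ → ∀ u v x y →
  (⟦ d u v ℕ.+ d x y ⟧ ≤ ⟦ d u x ℕ.+ d v y ⟧ + (δ + δ))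
  ⊎ (⟦ d u v ℕ.+ d x y ⟧ ≤ ⟦ d u y ℕ.+ d v x ⟧ + (δ + δ))
hyperbolic⇒≤+2δ G d δ hyp u v x y = Sum.map ≤max⇒≤ ≤max⇒≤ (ℕ.⊔-sel s₂ s₃)
  where
  s₁ = d u v ℕ.+ d x y
  s₂ = d u x ℕ.+ d v y
  s₃ = d u y ℕ.+ d v x
  ≤max⇒≤ : ∀ {s} → s₂ ℕ.⊔ s₃ ≡ s → ⟦ s₁ ⟧ ≤ ⟦ s ⟧ + (δ + δ)
  ≤max⇒≤ {s} max≡s = subst (λ m → ⟦ s₁ ⟧ ≤ ⟦ m ⟧ + (δ + δ)) max≡s (hyperbolic⇒≤⊔+2δ G d δ hyp u v x y)

+≤++⇒-≤- : ∀ A B C E t → A + B ≤ (C + E) + t → B - C - t ≤ E - A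
+≤++⇒-≤- A B C E t AB≤CE+t =
  subst₂ _≤_ (cancel A B C E t) (cancel′ A B C E t) (ℚ.+-monoˡ-≤ (ℚ.- A - C - t) AB≤CE+t)
  where
  open +-*-Solver
  cancel : ∀ A B C E t → (A + B) + (ℚ.- A - C - t) ≡ B - C - t
  cancel = solve 5 (λ A B C E t → (A :+ B) :+ (:- A :- C :- t) := B :- C :- t) refl
  cancel′ : ∀ A B C E t → ((C + E) + t) + (ℚ.- A - C - t) ≡ E - A
  cancel′ = solve 5 (λ A B C E t → ((C :+ E) :+ t) :+ (:- A :- C :- t) := E :- A) refl

⟦+⟧≤⟦+⟧+⇒-≤- : ∀ a b c e t → ⟦ a ℕ.+ b ⟧ ≤ ⟦ c ℕ.+ e ⟧ + t → ⟦ b ⟧ - ⟦ c ⟧ - t ≤ ⟦ e ⟧ - ⟦ a ⟧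
⟦+⟧≤⟦+⟧+⇒-≤- a b c e t ab≤ce+t = +≤++⇒-≤- ⟦ a ⟧ ⟦ b ⟧ ⟦ c ⟧ ⟦ e ⟧ t
  (subst₂ (λ p q → p ≤ q + t) (⟦⟧-homo-+ a b) (⟦⟧-homo-+ c e) ab≤ce+t)

lemma3 : ∀ {n : ℕ} (G : Graph n) (d : Fin n → Fin n → ℕ) (δ : ℚ) →
    Connected G → IsDistFun G d → NonNegative δ → Hyperbolic G d δ →
    ∀ (c v x y : Fin n) →
      (⟦ d c v ⟧ - ⟦ d y c ⟧ - (δ + δ) ≤ ⟦ d x v ⟧ - ⟦ d x y ⟧)
      ⊎ (⟦ d c v ⟧ - ⟦ d x c ⟧ - (δ + δ) ≤ ⟦ d y v ⟧ - ⟦ d x y ⟧)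
lemma3 G d δ _ _ _ hyp c v x y with hyperbolic⇒≤+2δ G d δ hyp x y c v
... | inj₁ ≤xc+yv = inj₂ (⟦+⟧≤⟦+⟧+⇒-≤- (d x y) (d c v) (d x c) (d y v) (δ + δ) ≤xc+yv)
... | inj₂ ≤xv+yc = inj₁ (⟦+⟧≤⟦+⟧+⇒-≤- (d x y) (d c v) (d y c) (d x v) (δ + δ)
                            (subst (λ s → ⟦ d x y ℕ.+ d c v ⟧ ≤ ⟦ s ⟧ + (δ + δ)) (ℕ.+-comm (d x v) (d y c)) ≤xv+yc))
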